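{- Let $n\ge1$, $r\ge2$ and $J\subseteq\Pi$. Then $\langle J\rangle=G_\mu$ for a unique signed composition $\mu$ of $n$. Consequently $G_{r,n}$ has exactly $2\cdot3^{n-1}$ distinct reflection subgroups (subgroups generated by a subset of $\Pi$).
   Context: $G_{r,n}$ is the group with generators $s_0,\dots,s_{n-1}$ and relations $s_0^r=1$, $s_i^2=1$ ($1\le i\le n-1$), $s_0s_1s_0s_1=s_1s_0s_1s_0$, $s_is_j=s_js_i$ for $|i-j|>1$, $s_is_{i+1}s_i=s_{i+1}s_is_{i+1}$ ($1\le i\le n-2$). Put $t_1=s_0$, $t_{i+1}=s_it_is_i$ and $\Pi=\{t_1,\dots,t_n,s_1,\dots,s_{n-1}\}$. A signed composition of $n$ is a sequence $\mu=(\mu_1,\dots,\mu_k)$ of nonzero integers with $\sum|\mu_i|=n$; put $\bar\mu_0=0$, $\bar\mu_i=|\mu_1|+\dots+|\mu_i|$. $\Pi_\mu$ consists of all $s_j$ with $\bar\mu_{i-1}<j<\bar\mu_i$ for some $i$, and all $t_j$ with $\bar\mu_{i-1}<j\le\bar\mu_i$ for some $i$ with $\mu_i>0$; $G_\mu=\langle\Pi_\mu\rangle$. -}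

module Defs where

open import Data.Nat using (ℕ; zero; suc; _+_; _*_; _∸_; _^_; _≤_; _<_)
open import Data.Integer as ℤ using (ℤ; ∣_∣) renaming (_<_ to _<ℤ_)
open import Data.Fin using (Fin; zero; suc; toℕ; fromℕ<)
open import Data.Fin.Properties using (toℕ<n)
open import Data.Nat.Properties using (≤-trans; n≤1+n)
open import Data.Nat.ListAction using (sum)
open import Data.Bool using (Bool; true; false; not; T)
open import Data.List using (List; []; _∷_; _++_; replicate; reverse; map; concat)
open import Data.List.Relation.Unary.All using (All)
open import Data.List.Relation.Unary.Any using (Any)
open import Data.Product using (Σ; ∃; _×_; _,_)
open import Relation.Binary.PropositionalEquality using (_≡_; _≢_)
open import Function.Bundles using (_⇔_)

-- The group G_{r,n} by generators and relations (free-group words modulo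
-- the congruence generated by free cancellation and the relations).
-- Generator i : Fin n stands for s_i (s_0 = generator with toℕ i ≡ 0).

-- A letter: a generator with a sign (true = s_i, false = s_i⁻¹).
Letter : ℕ → Set
Letter n = Fin n × Bool

Word : ℕ → Set
Word n = List (Letter n)

gen : ∀ {n} → Fin n → Letter n
gen i = (i , true)

invL : ∀ {n} → Letter n → Letter n
invL (i , b) = (i , not b)

invW : ∀ {n} → Word n → Word n
invW w = reverse (map invL w)

data Rel (n r : ℕ) : Word n → Word n → Set where
  order0 : (z : Fin n) → toℕ z ≡ 0 →
           Rel n r (replicate r (gen z)) []
  invol  : (i : Fin n) → 1 ≤ toℕ i →
           Rel n r (gen i ∷ gen i ∷ []) []
  four   : (z o : Fin n) → toℕ z ≡ 0 → toℕ o ≡ 1 →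
           Rel n r (gen z ∷ gen o ∷ gen z ∷ gen o ∷ [])
                   (gen o ∷ gen z ∷ gen o ∷ gen z ∷ [])
  comm   : (i j : Fin n) → 2 + toℕ i ≤ toℕ j →
           Rel n r (gen i ∷ gen j ∷ []) (gen j ∷ gen i ∷ [])
  braid  : (i j : Fin n) → 1 ≤ toℕ i → toℕ j ≡ suc (toℕ i) →
           Rel n r (gen i ∷ gen j ∷ gen i ∷ []) (gen j ∷ gen i ∷ gen j ∷ [])

data Eq (n r : ℕ) : Word n → Word n → Set where
  eq-refl  : ∀ {u} → Eq n r u u
  eq-sym   : ∀ {u v} → Eq n r u v → Eq n r v u
  eq-trans : ∀ {u v w} → Eq n r u v → Eq n r v w → Eq n r u w
  eq-cong  : ∀ {u v} (a b : Word n) → Eq n r u v → Eq n r (a ++ u ++ b) (a ++ v ++ b)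
  eq-canc  : (x : Letter n) → Eq n r (x ∷ invL x ∷ []) []
  eq-rel   : ∀ {u v} → Rel n r u v → Eq n r u v

-- t j (j : Fin n) is the word for t_{toℕ j + 1}:
-- t_1 = s_0,  t_{i+1} = s_i t_i s_i.
tAux : ∀ {n} (k : ℕ) → k < n → Word n
tAux zero    p = gen (fromℕ< p) ∷ []
tAux (suc k) p = gen (fromℕ< p) ∷ tAux k (≤-trans (n≤1+n (suc k)) p) ++ gen (fromℕ< p) ∷ []

tW : ∀ {n} → Fin n → Word n
tW j = tAux (toℕ j) (toℕ<n j)

-- Indices of elements of Π: tI j is t_{toℕ j + 1}; sI i _ is s_{toℕ i}, 1 ≤ toℕ i.
data PiIdx (n : ℕ) : Set where
  tI : Fin n → PiIdx n
  sI : (i : Fin n) → 1 ≤ toℕ i → PiIdx n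

piWord : ∀ {n} → PiIdx n → Word n
piWord (tI j)   = tW j
piWord (sI i _) = gen i ∷ []

InGen : (n r : ℕ) → (PiIdx n → Set) → Word n → Set
InGen n r S w =
  ∃ λ (xs : List ((Σ (PiIdx n) S) × Bool)) →
    Eq n r w (concat (map (λ { ((p , _) , true) → piWord p
                             ; ((p , _) , false) → invW (piWord p) }) xs))

SameSub : (n r : ℕ) → (PiIdx n → Set) → (PiIdx n → Set) → Set
SameSub n r S S' = ∀ (w : Word n) → InGen n r S w ⇔ InGen n r S' w

toPred : ∀ {n} → (PiIdx n → Bool) → PiIdx n → Set
toPred J p = T (J p)

SignedComposition : ℕ → List ℤ → Set
SignedComposition n μ = All (λ z → z ≢ ℤ.0ℤ) μ × sum (map ∣_∣ μ) ≡ n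

-- blocks off μ lists (μ̄_{i-1}, μ̄_i, μ_i) for each part (offset off).
blocks : ℕ → List ℤ → List (ℕ × ℕ × ℤ)
blocks off []       = []
blocks off (m ∷ ms) = (off , off + ∣ m ∣ , m) ∷ blocks (off + ∣ m ∣) ms

PiMu : ∀ {n} → List ℤ → PiIdx n → Set
PiMu μ (sI i _) = Any (λ { (a , b , m) → a < toℕ i × toℕ i < b }) (blocks 0 μ)
PiMu μ (tI j)   = Any (λ { (a , b , m) → a < suc (toℕ j) × suc (toℕ j) ≤ b × ℤ.0ℤ <ℤ m })
                      (blocks 0 μ)

module Submission where

-- A shape of the positions 0 … n-1 says where blocks are cut and which
-- blocks are positive; it determines a subset of Π, which for the parts of
-- a signed composition μ is Π_μ.

open import Defs
open import Data.Nat using (ℕ; zero; suc; _+_; _*_; _∸_; _^_; _≤_; _<_; z≤n; s≤s; pred; _≡ᵇ_; _%_; >-nonZero)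
open import Data.Nat.Properties
open import Data.Nat.DivMod using (%-distribˡ-+; m%n%n≡m%n; [m+n]%n≡m%n; m<n⇒m%n≡m; m%n<n)
open import Data.Nat.ListAction using (sum)
open import Data.Integer as ℤ using (ℤ; -[1+_]; ∣_∣) renaming (_<_ to _<ℤ_)
open import Data.Bool using (Bool; true; false; not; T; if_then_else_; _∨_; _∧_)
open import Data.Bool.Properties using (T-≡; T-not-≡; T-∨; T-∧; not-injective; not-involutive; ∨-idem; ∨-assoc; ∨-comm)
open import Data.Fin using (Fin; toℕ; fromℕ<)
open import Data.Fin.Properties using (toℕ<n; toℕ-fromℕ<; fromℕ<-toℕ; fromℕ<-cong)
open import Data.List using (List; []; _∷_; _++_; replicate; reverse; map; concat; length)
open import Data.List.Properties using (∷-injectiveʳ; ++-assoc; ++-identityʳ; map-++; reverse-++; map-cong; concat-++; length-++; length-map)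
open import Data.List.Relation.Unary.All as All using (All; []; _∷_)
import Data.List.Relation.Unary.All.Properties as AllP
open import Data.List.Relation.Unary.Any as Any using (Any; here; there)
import Data.List.Relation.Unary.Any.Properties as AnyP
open import Data.List.Relation.Unary.AllPairs as AllPairs using (AllPairs; []; _∷_)
import Data.List.Relation.Unary.AllPairs.Properties as AllPairsP
open import Data.Product using (Σ; ∃; _×_; _,_; proj₁; proj₂)
open import Data.Sum using (_⊎_; inj₁; inj₂)
open import Data.Empty using (⊥-elim)
open import Function using (_∘_)
open import Function.Bundles using (_⇔_; mk⇔; Equivalence)
open import Relation.Nullary using (¬_; yes; no; contradiction)
open import Relation.Binary.PropositionalEquality
open import Relation.Binary.Bundles using (Setoid)
open import Relation.Binary.Definitions using (tri<; tri≈; tri>)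
import Relation.Binary.Reasoning.Setoid as SetoidReasoning
open import Level using (0ℓ)

invL-involutive : ∀ {n} (x : Letter n) → invL (invL x) ≡ x
invL-involutive (i , true)  = refl
invL-involutive (i , false) = refl

invW-++ : ∀ {n} (u v : Word n) → invW (u ++ v) ≡ invW v ++ invW u
invW-++ u v = trans (cong reverse (map-++ invL u v)) (reverse-++ (map invL u) (map invL v))

invW-involutive : ∀ {n} (w : Word n) → invW (invW w) ≡ w
invW-involutive []      = refl
invW-involutive (x ∷ w) = begin
  invW (invW ((x ∷ []) ++ w))           ≡⟨ cong invW (invW-++ (x ∷ []) w) ⟩
  invW (invW w ++ (invL x ∷ []))        ≡⟨ invW-++ (invW w) (invL x ∷ []) ⟩
  invL (invL x) ∷ invW (invW w)         ≡⟨ cong₂ _∷_ (invL-involutive x) (invW-involutive w) ⟩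
  x ∷ w                                 ∎
  where open ≡-Reasoning

module Congruence (n r : ℕ) where

  ≡⇒Eq : ∀ {u v : Word n} → u ≡ v → Eq n r u v
  ≡⇒Eq refl = eq-refl

  ++-cong : ∀ {u u′ v v′ : Word n} → Eq n r u u′ → Eq n r v v′ → Eq n r (u ++ v) (u′ ++ v′)
  ++-cong {u} {u′} {v} {v′} e f =
    eq-trans (eq-cong [] v e)
    (eq-trans (≡⇒Eq (cong (u′ ++_) (sym (++-identityʳ v))))
    (eq-trans (eq-cong u′ [] f) (≡⇒Eq (cong (u′ ++_) (++-identityʳ v′)))))

  inverseʳ : ∀ (u : Word n) → Eq n r (u ++ invW u) []
  inverseʳ []      = eq-refl
  inverseʳ (x ∷ u) =
    eq-trans (≡⇒Eq regroup) (eq-trans (eq-cong (x ∷ []) (invL x ∷ []) (inverseʳ u)) (eq-canc x))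
    where
      regroup : (x ∷ u) ++ invW (x ∷ u) ≡ (x ∷ []) ++ (u ++ invW u) ++ (invL x ∷ [])
      regroup = cong (x ∷_) (trans (cong (u ++_) (invW-++ (x ∷ []) u))
                                   (sym (++-assoc u (invW u) (invL x ∷ []))))

  inverseˡ : ∀ (u : Word n) → Eq n r (invW u ++ u) []
  inverseˡ u = subst (λ z → Eq n r (invW u ++ z) []) (invW-involutive u) (inverseʳ (invW u))

  wordSetoid : Setoid 0ℓ 0ℓ
  wordSetoid = record
    { Carrier = Word n ; _≈_ = Eq n r
    ; isEquivalence = record { refl = eq-refl ; sym = eq-sym ; trans = eq-trans } }

  invW-cong : ∀ {u v : Word n} → Eq n r u v → Eq n r (invW u) (invW v)
  invW-cong {u} {v} e = begin
    invW u                          ≡⟨ ++-identityʳ (invW u) ⟨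
    invW u ++ []                    ≈⟨ ++-cong {invW u} eq-refl (inverseʳ v) ⟨
    invW u ++ (v ++ invW v)         ≈⟨ ++-cong {invW u} eq-refl (++-cong (eq-sym e) eq-refl) ⟩
    invW u ++ (u ++ invW v)         ≡⟨ ++-assoc (invW u) u (invW v) ⟨
    (invW u ++ u) ++ invW v         ≈⟨ ++-cong (inverseˡ u) eq-refl ⟩
    invW v                          ∎
    where open SetoidReasoning wordSetoid

module Generated (n r : ℕ) where
  open Congruence n r

  SignedGen : (PiIdx n → Set) → Set
  SignedGen S = Σ (PiIdx n) S × Bool

  genWord : ∀ {S} → SignedGen S → Word n
  genWord ((p , _) , true)  = piWord p
  genWord ((p , _) , false) = invW (piWord p)

  Products : (S : PiIdx n → Set) → Word n → Set
  Products S w = ∃ λ (xs : List (SignedGen S)) → Eq n r w (concat (map genWord xs))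

  fromProducts : ∀ {S w} → Products S w → InGen n r S w
  fromProducts (xs , e) = xs , subst (Eq n r _) (cong concat (map-cong pointwise xs)) e
    where
      -- the right-hand side is the (anonymous) generator map of InGen
      pointwise : ∀ x → genWord x ≡ _
      pointwise ((p , _) , true)  = refl
      pointwise ((p , _) , false) = refl

  toProducts : ∀ {S w} → InGen n r S w → Products S w
  toProducts (xs , e) = xs , subst (Eq n r _) (sym (cong concat (map-cong pointwise xs))) e
    where
      pointwise : ∀ x → genWord x ≡ _
      pointwise ((p , _) , true)  = refl
      pointwise ((p , _) , false) = refl

  InGen-resp : ∀ {S u v} → Eq n r u v → InGen n r S v → InGen n r S u
  InGen-resp e (xs , f) = xs , eq-trans e f

  InGen-[] : ∀ {S} → InGen n r S []
  InGen-[] = [] , eq-refl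

  InGen-gen : ∀ {S} p → S p → InGen n r S (piWord p)
  InGen-gen p s = fromProducts ((((p , s) , true) ∷ []) , ≡⇒Eq (sym (++-identityʳ (piWord p))))

  InGen-++ : ∀ {S u v} → InGen n r S u → InGen n r S v → InGen n r S (u ++ v)
  InGen-++ p q with toProducts p | toProducts q
  ... | xs , e | ys , f = fromProducts ((xs ++ ys) , eq-trans (++-cong e f) (≡⇒Eq concatenate))
    where
      concatenate : concat (map genWord xs) ++ concat (map genWord ys) ≡ concat (map genWord (xs ++ ys))
      concatenate = trans (concat-++ (map genWord xs) (map genWord ys))
                          (cong concat (sym (map-++ genWord xs ys)))

  InGen-inv : ∀ {S u} → InGen n r S u → InGen n r S (invW u)
  InGen-inv {S} p with toProducts p
  ... | xs , e = InGen-resp (invW-cong e) (inverse xs)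
    where
      letterInverse : ∀ x → InGen n r S (invW (genWord x))
      letterInverse ((p , s) , true)  =
        fromProducts ((((p , s) , false) ∷ []) , ≡⇒Eq (sym (++-identityʳ _)))
      letterInverse ((p , s) , false) =
        subst (InGen n r S) (sym (invW-involutive (piWord p))) (InGen-gen p s)
      inverse : ∀ xs → InGen n r S (invW (concat (map genWord xs)))
      inverse []       = InGen-[]
      inverse (x ∷ xs) = subst (InGen n r S) (sym (invW-++ (genWord x) _))
                               (InGen-++ (inverse xs) (letterInverse x))

  InGen-mono : ∀ {S S′} → (∀ p → S′ p → InGen n r S (piWord p)) →
               ∀ {w} → InGen n r S′ w → InGen n r S w
  InGen-mono {S} h q with toProducts q
  ... | xs , e = InGen-resp e (product xs)
    where
      product : ∀ xs → InGen n r S (concat (map genWord xs))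
      product []                        = InGen-[]
      product (((p , s) , true)  ∷ xs) = InGen-++ (h p s) (product xs)
      product (((p , s) , false) ∷ xs) = InGen-++ (InGen-inv (h p s)) (product xs)

  sameSub-intro : ∀ {S S′} → (∀ p → S p → InGen n r S′ (piWord p)) →
                  (∀ p → S′ p → InGen n r S (piWord p)) → SameSub n r S S′
  sameSub-intro h h′ w = mk⇔ (InGen-mono h) (InGen-mono h′)

  sameSub-sym : ∀ {S S′} → SameSub n r S S′ → SameSub n r S′ S
  sameSub-sym h w = mk⇔ (Equivalence.from (h w)) (Equivalence.to (h w))

  sameSub-trans : ∀ {S S′ S″} → SameSub n r S S′ → SameSub n r S′ S″ → SameSub n r S S″
  sameSub-trans h h′ w = mk⇔ (Equivalence.to (h′ w) ∘ Equivalence.to (h w))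
                             (Equivalence.from (h w) ∘ Equivalence.from (h′ w))

  sameSub-gen : ∀ {S S′} → SameSub n r S S′ → ∀ p → S p → InGen n r S′ (piWord p)
  sameSub-gen h p s = Equivalence.to (h (piWord p)) (InGen-gen p s)

  sameSub-≗ : ∀ {J J′ : PiIdx n → Bool} → (∀ p → J p ≡ J′ p) → SameSub n r (toPred J) (toPred J′)
  sameSub-≗ eq = sameSub-intro (λ p t → InGen-gen p (subst T (eq p) t))
                               (λ p t → InGen-gen p (subst T (sym (eq p)) t))

swap : ℕ → ℕ → ℕ
swap zero    zero          = 1
swap zero    (suc zero)    = 0
swap zero    (suc (suc c)) = suc (suc c)
swap (suc m) zero          = zero
swap (suc m) (suc c)       = suc (swap m c)

swap-involutive : ∀ m c → swap m (swap m c) ≡ c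
swap-involutive zero    zero          = refl
swap-involutive zero    (suc zero)    = refl
swap-involutive zero    (suc (suc c)) = refl
swap-involutive (suc m) zero          = refl
swap-involutive (suc m) (suc c)       = cong suc (swap-involutive m c)

swap-braid : ∀ m c → swap m (swap (suc m) (swap m c)) ≡ swap (suc m) (swap m (swap (suc m) c))
swap-braid zero    zero                = refl
swap-braid zero    (suc zero)          = refl
swap-braid zero    (suc (suc zero))    = refl
swap-braid zero    (suc (suc (suc c))) = refl
swap-braid (suc m) zero                = refl
swap-braid (suc m) (suc c)             = cong suc (swap-braid m c)

swap-comm : ∀ m m′ c → 2 + m ≤ m′ → swap m (swap m′ c) ≡ swap m′ (swap m c)
swap-comm zero    (suc zero)      c             (s≤s ())
swap-comm zero    (suc (suc m″)) zero          _ = refl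
swap-comm zero    (suc (suc m″)) (suc zero)    _ = refl
swap-comm zero    (suc (suc m″)) (suc (suc c)) _ = refl
swap-comm (suc m) (suc m′)        zero          _ = refl
swap-comm (suc m) (suc m′)        (suc c)       (s≤s le) = cong suc (swap-comm m m′ c le)

swap-cases : ∀ m c → (swap m c ≡ c) ⊎ ((c ≡ m) × (swap m c ≡ suc m)) ⊎ ((c ≡ suc m) × (swap m c ≡ m))
swap-cases zero    zero          = inj₂ (inj₁ (refl , refl))
swap-cases zero    (suc zero)    = inj₂ (inj₂ (refl , refl))
swap-cases zero    (suc (suc c)) = inj₁ refl
swap-cases (suc m) zero          = inj₁ refl
swap-cases (suc m) (suc c) with swap-cases m c
... | inj₁ e                 = inj₁ (cong suc e)
... | inj₂ (inj₁ (e₁ , e₂)) = inj₂ (inj₁ (cong suc e₁ , cong suc e₂))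
... | inj₂ (inj₂ (e₁ , e₂)) = inj₂ (inj₂ (cong suc e₁ , cong suc e₂))

swap-self : ∀ m → swap m m ≡ suc m
swap-self zero    = refl
swap-self (suc m) = cong suc (swap-self m)

swap-≡ᵇ : ∀ m c → (swap m c ≡ᵇ m) ≡ (c ≡ᵇ suc m)
swap-≡ᵇ zero    zero          = refl
swap-≡ᵇ zero    (suc zero)    = refl
swap-≡ᵇ zero    (suc (suc c)) = refl
swap-≡ᵇ (suc m) zero          = refl
swap-≡ᵇ (suc m) (suc c)       = swap-≡ᵇ m c

iterate : ∀ {A : Set} → ℕ → (A → A) → A → A
iterate zero    f x = x
iterate (suc j) f x = f (iterate j f x)

iterate-comm : ∀ {A : Set} j (f : A → A) x → iterate j f (f x) ≡ f (iterate j f x)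
iterate-comm zero    f x = refl
iterate-comm (suc j) f x = cong f (iterate-comm j f x)

-- G_{r,n} acts on coloured points (c , a), a position c ∈ ℕ carrying a
-- colour a ∈ ℤ/r: s_0 rotates the colour of the point at position 0 and
-- s_i (i ≥ 1) exchanges the positions i-1 and i.  (This is the monomial
-- representation of G_{r,n}, restricted to the multiples of basis
-- vectors by r-th roots of unity.)
Point : Set
Point = ℕ × ℕ

module ColouredPoints (k : ℕ) where

  r : ℕ
  r = suc k

  rotate : ℕ → ℕ
  rotate a = suc a % r

  unrotate : ℕ → ℕ
  unrotate = iterate k rotate

  rotate-% : ∀ x → rotate (x % r) ≡ suc x % r
  rotate-% x = begin
    suc (x % r) % r           ≡⟨ %-distribˡ-+ 1 (x % r) r ⟩
    (1 % r + x % r % r) % r   ≡⟨ cong (λ z → (1 % r + z) % r) (m%n%n≡m%n x r) ⟩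
    (1 % r + x % r) % r       ≡⟨ %-distribˡ-+ 1 x r ⟨
    suc x % r                 ∎
    where open ≡-Reasoning

  rotate^ : ∀ j a → a < r → iterate j rotate a ≡ (a + j) % r
  rotate^ zero    a a<r = trans (sym (m<n⇒m%n≡m a<r)) (cong (_% r) (sym (+-identityʳ a)))
  rotate^ (suc j) a a<r =
    trans (cong rotate (rotate^ j a a<r)) (trans (rotate-% (a + j)) (cong (_% r) (sym (+-suc a j))))

  rotate-order : ∀ a → a < r → iterate r rotate a ≡ a
  rotate-order a a<r = trans (rotate^ r a a<r) (trans ([m+n]%n≡m%n a r) (m<n⇒m%n≡m a<r))

  rotate-unrotate : ∀ a → a < r → rotate (unrotate a) ≡ a
  rotate-unrotate = rotate-order

  unrotate-rotate : ∀ a → a < r → unrotate (rotate a) ≡ a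
  unrotate-rotate a a<r = trans (iterate-comm k rotate a) (rotate-order a a<r)

  rotate^<r : ∀ j a → a < r → iterate j rotate a < r
  rotate^<r zero    a a<r = a<r
  rotate^<r (suc j) a a<r = m%n<n (suc (iterate j rotate a)) r

  actGen : ℕ → Bool → Point → Point
  actGen zero    true  (zero , a)  = (zero , rotate a)
  actGen zero    false (zero , a)  = (zero , unrotate a)
  actGen zero    _     (suc c , a) = (suc c , a)
  actGen (suc m) _     (c , a)     = (swap m c , a)

  act : ∀ {n} → Word n → Point → Point
  act []            x = x
  act ((i , b) ∷ w) x = actGen (toℕ i) b (act w x)

  act-++ : ∀ {n} (u v : Word n) x → act (u ++ v) x ≡ act u (act v x)
  act-++ []      v x = refl
  act-++ (_ ∷ u) v x = cong (actGen _ _) (act-++ u v x)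

  Valid : Point → Set
  Valid (_ , a) = a < r

  actGen-valid : ∀ m b x → Valid x → Valid (actGen m b x)
  actGen-valid zero    true  (zero , a)  a<r = m%n<n (suc a) r
  actGen-valid zero    false (zero , a)  a<r = rotate^<r k a a<r
  actGen-valid zero    true  (suc c , a) a<r = a<r
  actGen-valid zero    false (suc c , a) a<r = a<r
  actGen-valid (suc m) b     (c , a)     a<r = a<r

  act-valid : ∀ {n} (w : Word n) x → Valid x → Valid (act w x)
  act-valid []            x v = v
  act-valid ((i , b) ∷ w) x v = actGen-valid (toℕ i) b (act w x) (act-valid w x v)

  actGen-cancel : ∀ m b x → Valid x → actGen m b (actGen m (not b) x) ≡ x
  actGen-cancel zero    true  (zero , a)  a<r = cong (zero ,_) (rotate-unrotate a a<r)
  actGen-cancel zero    false (zero , a)  a<r = cong (zero ,_) (unrotate-rotate a a<r)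
  actGen-cancel zero    true  (suc c , a) _   = refl
  actGen-cancel zero    false (suc c , a) _   = refl
  actGen-cancel (suc m) b     (c , a)     _   = cong (_, a) (swap-involutive m c)

  act-s₀^ : ∀ {n} (z : Fin n) → toℕ z ≡ 0 → ∀ j a →
            act (replicate j (gen z)) (zero , a) ≡ (zero , iterate j rotate a)
  act-s₀^ z z≡0 zero    a = refl
  act-s₀^ z z≡0 (suc j) a rewrite act-s₀^ z z≡0 j a | z≡0 = refl

  act-s₀^-fixes : ∀ {n} (z : Fin n) → toℕ z ≡ 0 → ∀ j c a →
                  act (replicate j (gen z)) (suc c , a) ≡ (suc c , a)
  act-s₀^-fixes z z≡0 zero    c a = refl
  act-s₀^-fixes z z≡0 (suc j) c a rewrite act-s₀^-fixes z z≡0 j c a | z≡0 = refl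

  act-order : ∀ {n} (z : Fin n) → toℕ z ≡ 0 → ∀ x → Valid x → act (replicate r (gen z)) x ≡ x
  act-order z z≡0 (zero , a)  a<r = trans (act-s₀^ z z≡0 r a) (cong (zero ,_) (rotate-order a a<r))
  act-order z z≡0 (suc c , a) _   = act-s₀^-fixes z z≡0 r c a

  act-involution : ∀ m → 1 ≤ m → ∀ x → actGen m true (actGen m true x) ≡ x
  act-involution (suc m) _ (c , a) = cong (_, a) (swap-involutive m c)

  act-four : ∀ x → actGen 0 true (actGen 1 true (actGen 0 true (actGen 1 true x)))
                 ≡ actGen 1 true (actGen 0 true (actGen 1 true (actGen 0 true x)))
  act-four (zero , a)        = refl
  act-four (suc zero , a)    = refl
  act-four (suc (suc c) , a) = refl

  act-comm : ∀ m m′ → 2 + m ≤ m′ → ∀ x → actGen m true (actGen m′ true x) ≡ actGen m′ true (actGen m true x)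
  act-comm zero    (suc zero)      (s≤s ()) x
  act-comm zero    (suc (suc m″)) _ (zero , a)  = refl
  act-comm zero    (suc (suc m″)) _ (suc c , a) = refl
  act-comm (suc m) (suc m′)        (s≤s le) (c , a) = cong (_, a) (swap-comm m m′ c le)

  act-braid : ∀ m → 1 ≤ m → ∀ x → actGen m true (actGen (suc m) true (actGen m true x))
                                  ≡ actGen (suc m) true (actGen m true (actGen (suc m) true x))
  act-braid (suc m) _ (c , a) = cong (_, a) (swap-braid m c)

  act-resp-Rel : ∀ {n u v} → Rel n r u v → ∀ x → Valid x → act u x ≡ act v x
  act-resp-Rel (order0 z z≡0)          x v = act-order z z≡0 x v
  act-resp-Rel (invol i 1≤i)           x v = act-involution (toℕ i) 1≤i x
  act-resp-Rel (four z o z≡0 o≡1)      x v rewrite z≡0 | o≡1 = act-four x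
  act-resp-Rel (comm i j le)           x v = act-comm (toℕ i) (toℕ j) le x
  act-resp-Rel (braid i j 1≤i j≡1+i)   x v rewrite j≡1+i = act-braid (toℕ i) 1≤i x

  act-resp-Eq : ∀ {n u v} → Eq n r u v → ∀ x → Valid x → act u x ≡ act v x
  act-resp-Eq eq-refl          x v = refl
  act-resp-Eq (eq-sym e)       x v = sym (act-resp-Eq e x v)
  act-resp-Eq (eq-trans e f)   x v = trans (act-resp-Eq e x v) (act-resp-Eq f x v)
  act-resp-Eq (eq-cong {u} {u′} a b e) x v = begin
    act (a ++ u ++ b) x       ≡⟨ act-++ a (u ++ b) x ⟩
    act a (act (u ++ b) x)    ≡⟨ cong (act a) (act-++ u b x) ⟩
    act a (act u (act b x))   ≡⟨ cong (act a) (act-resp-Eq e (act b x) (act-valid b x v)) ⟩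
    act a (act u′ (act b x))  ≡⟨ cong (act a) (act-++ u′ b x) ⟨
    act a (act (u′ ++ b) x)   ≡⟨ act-++ a (u′ ++ b) x ⟨
    act (a ++ u′ ++ b) x      ∎
    where open ≡-Reasoning
  act-resp-Eq (eq-canc (i , b)) x v = actGen-cancel (toℕ i) b x v
  act-resp-Eq (eq-rel ρ)       x v = act-resp-Rel ρ x v

  rotateAt : ℕ → Point → Point
  rotateAt j (c , a) = (c , (if c ≡ᵇ j then rotate a else a))

  act-t : ∀ {n} j (p : j < n) x → act (tAux j p) x ≡ rotateAt j x
  act-t zero p (c , a) rewrite toℕ-fromℕ< p with c
  ... | zero  = refl
  ... | suc _ = refl
  act-t {n} (suc j) p (c , a) = begin
    act (g ∷ tAux j p′ ++ g ∷ []) (c , a)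
      ≡⟨ cong (actGen (toℕ i) true) (act-++ (tAux j p′) (g ∷ []) (c , a)) ⟩
    actGen (toℕ i) true (act (tAux j p′) (actGen (toℕ i) true (c , a)))
      ≡⟨ cong (λ m → actGen m true (act (tAux j p′) (actGen m true (c , a)))) (toℕ-fromℕ< p) ⟩
    actGen (suc j) true (act (tAux j p′) (swap j c , a))
      ≡⟨ cong (actGen (suc j) true) (act-t j p′ (swap j c , a)) ⟩
    (swap j (swap j c) , (if swap j c ≡ᵇ j then rotate a else a))
      ≡⟨ cong₂ _,_ (swap-involutive j c) (cong (λ b → if b then rotate a else a) (swap-≡ᵇ j c)) ⟩
    rotateAt (suc j) (c , a) ∎
    where
      open ≡-Reasoning
      i : Fin n
      i = fromℕ< p
      g : Letter n
      g = gen i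
      p′ : j < n
      p′ = ≤-trans (n≤1+n (suc j)) p

-- A shape is a pair of predicates on positions: cut c says that c and c+1
-- lie in different blocks, pos c that the block of c is positive.  Its
-- generating set contains s_i iff ¬ cut (i-1), and t_{j+1} iff pos j; for
-- the parts of a signed composition this is exactly Π_μ.
shapeSet : ∀ {n} (cut pos : ℕ → Bool) → PiIdx n → Bool
shapeSet cut pos (tI j)   = pos (toℕ j)
shapeSet cut pos (sI i _) = not (cut (pred (toℕ i)))

Consistent : ℕ → (cut pos : ℕ → Bool) → Set
Consistent n cut pos = ∀ c → suc c < n → cut c ≡ false → pos c ≡ pos (suc c)

-- Rigidity: a generator from Π lies in the subgroup generated by a
-- consistent shape only if it belongs to the shape (for r ≥ 2).  Every
-- element of that subgroup keeps each coloured point inside its block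
-- and fixes the colours in negative blocks; s_i with cut (i-1) moves a
-- point to another block, and t_{j+1} recolours the point j.
module Rigidity (k n : ℕ) (cut pos : ℕ → Bool) (consistent : Consistent n cut pos) where
  open ColouredPoints k
  open Congruence n r
  open Generated n r

  Shape : PiIdx n → Set
  Shape = toPred (shapeSet cut pos)

  blockIndex : ℕ → ℕ
  blockIndex zero    = zero
  blockIndex (suc c) = if cut c then suc (blockIndex c) else blockIndex c

  record KeepsAt (f : Point → Point) (c a : ℕ) : Set where
    field
      block  : blockIndex (proj₁ (f (c , a))) ≡ blockIndex c
      sign   : pos (proj₁ (f (c , a))) ≡ pos c
      colour : pos c ≡ false → proj₂ (f (c , a)) ≡ a
  open KeepsAt

  Respects : (Point → Point) → Set
  Respects f = ∀ c a → a < r → KeepsAt f c a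

  respects-[] : Respects (act {n} [])
  respects-[] c a _ = record { block = refl ; sign = refl ; colour = λ _ → refl }

  respects-++ : ∀ (u v : Word n) → Respects (act u) → Respects (act v) → Respects (act (u ++ v))
  respects-++ u v ru rv c a a<r = record
    { block  = trans (cong (blockIndex ∘ proj₁) split) (trans (block outer) (block inner))
    ; sign   = trans (cong (pos ∘ proj₁) split) (trans (sign outer) (sign inner))
    ; colour = λ neg → trans (cong proj₂ split)
                             (trans (colour outer (trans (sign inner) neg)) (colour inner neg))
    }
    where
      split : act (u ++ v) (c , a) ≡ act u (act v (c , a))
      split = act-++ u v (c , a)
      inner : KeepsAt (act v) c a
      inner = rv c a a<r
      outer : KeepsAt (act u) (proj₁ (act v (c , a))) (proj₂ (act v (c , a)))
      outer = ru _ _ (act-valid v (c , a) a<r)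

  respects-resp-Eq : ∀ {w w′ : Word n} → Eq n r w w′ → Respects (act w′) → Respects (act w)
  respects-resp-Eq {w} {w′} e rw c a a<r = record
    { block  = trans (cong (blockIndex ∘ proj₁) same) (block (rw c a a<r))
    ; sign   = trans (cong (pos ∘ proj₁) same) (sign (rw c a a<r))
    ; colour = λ neg → trans (cong proj₂ same) (colour (rw c a a<r) neg)
    }
    where
      same : act w (c , a) ≡ act w′ (c , a)
      same = act-resp-Eq e (c , a) a<r

  act-invW : ∀ (w : Word n) x → Valid x → act w (act (invW w) x) ≡ x
  act-invW w x v = trans (sym (act-++ w (invW w) x)) (act-resp-Eq (inverseʳ w) x v)

  respects-invW : ∀ (w : Word n) → Respects (act w) → Respects (act (invW w))
  respects-invW w rw c a a<r = record
    { block  = trans (sym (block atY)) (cong (blockIndex ∘ proj₁) back)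
    ; sign   = signEq
    ; colour = λ neg → trans (sym (colour atY (trans signEq neg))) (cong proj₂ back)
    }
    where
      y : Point
      y = act (invW w) (c , a)
      back : act w y ≡ (c , a)
      back = act-invW w (c , a) a<r
      atY : KeepsAt (act w) (proj₁ y) (proj₂ y)
      atY = rw (proj₁ y) (proj₂ y) (act-valid (invW w) (c , a) a<r)
      signEq : pos (proj₁ y) ≡ pos c
      signEq = trans (sym (sign atY)) (cong (pos ∘ proj₁) back)

  blockIndex-uncut : ∀ m → cut m ≡ false → blockIndex (suc m) ≡ blockIndex m
  blockIndex-uncut m uncut rewrite uncut = refl

  blockIndex-cut : ∀ m → cut m ≡ true → blockIndex (suc m) ≡ suc (blockIndex m)
  blockIndex-cut m isCut rewrite isCut = refl

  s-respects : ∀ m′ → m′ < n → 1 ≤ m′ → cut (pred m′) ≡ false → Respects (actGen m′ true)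
  s-respects (suc m) lt _ uncut c a _ with swap-cases m c
  ... | inj₁ fixed =
    record { block = cong blockIndex fixed ; sign = cong pos fixed ; colour = λ _ → refl }
  ... | inj₂ (inj₁ (refl , moved)) =
    record { block  = trans (cong blockIndex moved) (blockIndex-uncut m uncut)
           ; sign   = trans (cong pos moved) (sym (consistent m lt uncut))
           ; colour = λ _ → refl }
  ... | inj₂ (inj₂ (refl , moved)) =
    record { block  = trans (cong blockIndex moved) (sym (blockIndex-uncut m uncut))
           ; sign   = trans (cong pos moved) (consistent m lt uncut)
           ; colour = λ _ → refl }

  t-respects : ∀ j (p : j < n) → pos j ≡ true → Respects (act (tAux j p))
  t-respects j p positive c a _ = record
    { block  = cong (blockIndex ∘ proj₁) recolour
    ; sign   = cong (pos ∘ proj₁) recolour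
    ; colour = λ negative → trans (cong proj₂ recolour) (unchanged negative)
    }
    where
      recolour : act (tAux j p) (c , a) ≡ rotateAt j (c , a)
      recolour = act-t j p (c , a)
      unchanged : pos c ≡ false → (if c ≡ᵇ j then rotate a else a) ≡ a
      unchanged negative with c ≡ᵇ j in c≡ᵇj
      ... | false = refl
      ... | true  = contradiction (trans (sym positive) (trans (cong pos c≡j) negative)) (λ ())
        where
          c≡j : j ≡ c
          c≡j = sym (≡ᵇ⇒≡ c j (subst T (sym c≡ᵇj) _))

  shape-respects : ∀ p → Shape p → Respects (act (piWord p))
  shape-respects (tI j)   t = t-respects (toℕ j) (toℕ<n j) (Equivalence.to T-≡ t)
  shape-respects (sI i h) t = s-respects (toℕ i) (toℕ<n i) h (Equivalence.to T-not-≡ t)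

  InGen-respects : ∀ {w} → InGen n r Shape w → Respects (act w)
  InGen-respects q with toProducts q
  ... | xs , e = respects-resp-Eq e (product xs)
    where
      product : ∀ xs → Respects (act (concat (map genWord xs)))
      product [] = respects-[]
      product (((p , s) , true) ∷ xs) =
        respects-++ (piWord p) _ (shape-respects p s) (product xs)
      product (((p , s) , false) ∷ xs) =
        respects-++ (invW (piWord p)) _ (respects-invW (piWord p) (shape-respects p s)) (product xs)

  -- Conversely, s_{m+1} moves the point m to m+1, and t_{j+1} recolours
  -- the point j when r ≥ 2.
  s-respects⁻¹ : ∀ m′ → 1 ≤ m′ → Respects (actGen m′ true) → cut (pred m′) ≡ false
  s-respects⁻¹ (suc m) _ resp with cut m in isCut
  ... | false = refl
  ... | true  = contradiction staysInBlock 1+n≢n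
    where
      staysInBlock : suc (blockIndex m) ≡ blockIndex m
      staysInBlock = trans (sym (blockIndex-cut m isCut))
                           (trans (cong blockIndex (sym (swap-self m))) (block (resp m 0 (s≤s z≤n))))

  t-respects⁻¹ : 1 ≤ k → ∀ j (p : j < n) → Respects (act (tAux j p)) → pos j ≡ true
  t-respects⁻¹ 1≤k j p resp with pos j in negative
  ... | true  = refl
  ... | false = contradiction recoloured 1+n≢0
    where
      j≡ᵇj : (j ≡ᵇ j) ≡ true
      j≡ᵇj = Equivalence.to T-≡ (≡⇒≡ᵇ j j refl)
      recoloured : 1 ≡ 0
      recoloured = begin
        1                                     ≡⟨ m<n⇒m%n≡m (s≤s 1≤k) ⟨
        rotate 0                              ≡⟨ cong (λ b → if b then rotate 0 else 0) j≡ᵇj ⟨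
        proj₂ (rotateAt j (j , 0))            ≡⟨ cong proj₂ (act-t j p (j , 0)) ⟨
        proj₂ (act (tAux j p) (j , 0))        ≡⟨ colour (resp j 0 (s≤s z≤n)) negative ⟩
        0                                     ∎
        where open ≡-Reasoning

  member⇒inShape : 1 ≤ k → ∀ p → InGen n r Shape (piWord p) → Shape p
  member⇒inShape 1≤k (tI j) m =
    Equivalence.from T-≡ (t-respects⁻¹ 1≤k (toℕ j) (toℕ<n j) (InGen-respects m))
  member⇒inShape 1≤k (sI i h) m =
    Equivalence.from T-not-≡ (s-respects⁻¹ (toℕ i) h (InGen-respects m))

T-injective : ∀ {x y} → (T x → T y) → (T y → T x) → x ≡ y
T-injective {false} {false} _ _ = refl
T-injective {false} {true}  _ g = ⊥-elim (g _)
T-injective {true}  {false} f _ = ⊥-elim (f _)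
T-injective {true}  {true}  _ _ = refl

shape-rigid : ∀ k n {cut pos cut′ pos′} → 1 ≤ k →
              Consistent n cut pos → Consistent n cut′ pos′ →
              SameSub n (suc k) (toPred (shapeSet cut pos)) (toPred (shapeSet cut′ pos′)) →
              ∀ p → shapeSet cut pos p ≡ shapeSet cut′ pos′ p
shape-rigid k n {cut} {pos} {cut′} {pos′} 1≤k consistent consistent′ same p =
  T-injective (λ t → R′.member⇒inShape 1≤k p (sameSub-gen same p t))
              (λ t → R.member⇒inShape 1≤k p (sameSub-gen (sameSub-sym same) p t))
  where
    open Generated n (suc k)
    module R  = Rigidity k n cut pos consistent
    module R′ = Rigidity k n cut′ pos′ consistent′

-- The elements s_{c+1} and t_{c+1} of Π, indexed by positions c.
sAt : ∀ {n c} → suc c < n → PiIdx n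
sAt lt = sI (fromℕ< lt) (subst (1 ≤_) (sym (toℕ-fromℕ< lt)) (s≤s z≤n))

tAt : ∀ {n c} → c < n → PiIdx n
tAt lt = tI (fromℕ< lt)

module _ {n : ℕ} {cut pos cut′ pos′ : ℕ → Bool} where

  shapeSet⇒features : (∀ p → shapeSet {n} cut pos p ≡ shapeSet cut′ pos′ p) →
                      (∀ c → suc c < n → cut c ≡ cut′ c) × (∀ c → c < n → pos c ≡ pos′ c)
  shapeSet⇒features same =
    (λ c lt → not-injective (atIndex (λ m → not (cut (pred m))) (λ m → not (cut′ (pred m))) lt (same (sAt lt))))
    , (λ c lt → atIndex pos pos′ lt (same (tAt lt)))
    where
      atIndex : ∀ {c m} (f g : ℕ → Bool) (lt : c < m) → f (toℕ (fromℕ< lt)) ≡ g (toℕ (fromℕ< lt)) → f c ≡ g c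
      atIndex f g lt eq = subst (λ i → f i ≡ g i) (toℕ-fromℕ< lt) eq

  features⇒shapeSet : (∀ c → suc c < n → cut c ≡ cut′ c) → (∀ c → c < n → pos c ≡ pos′ c) →
                      ∀ p → shapeSet {n} cut pos p ≡ shapeSet cut′ pos′ p
  features⇒shapeSet cuts signs (tI j)   = signs (toℕ j) (toℕ<n j)
  features⇒shapeSet cuts signs (sI i h) = cong not (cuts (pred (toℕ i)) (subst (_< n) (sym (suc-pred (toℕ i) {{>-nonZero h}})) (toℕ<n i)))

-- Parts: a list of blocks (b , l), each of l+1 consecutive positions with
-- sign b.  These are signed compositions without the integer encoding.
Parts : Set
Parts = List (Bool × ℕ)

size : Parts → ℕ
size []            = 0
size ((_ , l) ∷ B) = suc l + size B

-- boundary B c: c is the last position of its block.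
boundary : Parts → ℕ → Bool
boundary []                  c       = false
boundary ((b , zero)  ∷ B)   zero    = true
boundary ((b , zero)  ∷ B)   (suc c) = boundary B c
boundary ((b , suc l) ∷ B)   zero    = false
boundary ((b , suc l) ∷ B)   (suc c) = boundary ((b , l) ∷ B) c

positive : Parts → ℕ → Bool
positive []                c       = false
positive ((b , zero)  ∷ B) zero    = b
positive ((b , zero)  ∷ B) (suc c) = positive B c
positive ((b , suc l) ∷ B) zero    = b
positive ((b , suc l) ∷ B) (suc c) = positive ((b , l) ∷ B) c

partsSet : ∀ {n} → Parts → PiIdx n → Bool
partsSet B = shapeSet (boundary B) (positive B)

parts-consistent : ∀ n B → Consistent n (boundary B) (positive B)
parts-consistent n B c _ = uncut B c
  where
    uncut : ∀ B c → boundary B c ≡ false → positive B c ≡ positive B (suc c)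
    uncut []                      c       _ = refl
    uncut ((b , zero)  ∷ B)       (suc c) h = uncut B c h
    uncut ((b , suc zero) ∷ B)    zero    _ = refl
    uncut ((b , suc (suc l)) ∷ B) zero    _ = refl
    uncut ((b , suc l) ∷ B)       (suc c) h = uncut ((b , l) ∷ B) c h

grow : Parts → Parts
grow []            = []
grow ((b , l) ∷ B) = (b , suc l) ∷ B

-- Parts of size m+1 are determined by their boundaries below m and their
-- signs up to m: the first boundary decides between "first block has
-- length one" and "first block is grown", and the rest is recursive.
parts-determined : ∀ m B B′ → size B ≡ suc m → size B′ ≡ suc m →
                   (∀ c → c < m → boundary B c ≡ boundary B′ c) →
                   (∀ c → c ≤ m → positive B c ≡ positive B′ c) → B ≡ B′
parts-determined zero ((b , zero) ∷ []) ((b′ , zero) ∷ []) _ _ _ signs =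
  cong (λ x → (x , zero) ∷ []) (signs 0 z≤n)
parts-determined zero ((b , zero) ∷ _ ∷ _) _ () _ _ _
parts-determined zero ((b , suc l) ∷ _)    _ () _ _ _
parts-determined zero ((b , zero) ∷ []) ((b′ , zero) ∷ _ ∷ _) _ () _ _
parts-determined zero ((b , zero) ∷ []) ((b′ , suc l) ∷ _)    _ () _ _
parts-determined (suc m) ((b , zero) ∷ B) ((b′ , zero) ∷ B′) sz sz′ cuts signs =
  cong₂ (λ x R → (x , zero) ∷ R) (signs 0 z≤n)
        (parts-determined m B B′ (suc-injective sz) (suc-injective sz′)
                          (λ c lt → cuts (suc c) (s≤s lt)) (λ c le → signs (suc c) (s≤s le)))
parts-determined (suc m) ((b , suc l) ∷ B) ((b′ , suc l′) ∷ B′) sz sz′ cuts signs =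
  cong grow (parts-determined m ((b , l) ∷ B) ((b′ , l′) ∷ B′) (suc-injective sz) (suc-injective sz′)
                              (λ c lt → cuts (suc c) (s≤s lt)) (λ c le → signs (suc c) (s≤s le)))
parts-determined (suc m) ((b , zero)  ∷ B) ((b′ , suc l′) ∷ B′) _ _ cuts _ =
  contradiction (cuts 0 (s≤s z≤n)) (λ ())
parts-determined (suc m) ((b , suc l) ∷ B) ((b′ , zero)   ∷ B′) _ _ cuts _ =
  contradiction (cuts 0 (s≤s z≤n)) (λ ())

parts-rigid : ∀ k m B B′ → 1 ≤ k → size B ≡ suc m → size B′ ≡ suc m →
              SameSub (suc m) (suc k) (toPred (partsSet B)) (toPred (partsSet B′)) → B ≡ B′
parts-rigid k m B B′ 1≤k sz sz′ same =
  parts-determined m B B′ sz sz′ (λ c lt → proj₁ features c (s≤s lt)) (λ c le → proj₂ features c (s≤s le))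
  where
    features : (∀ c → suc c < suc m → boundary B c ≡ boundary B′ c) × (∀ c → c < suc m → positive B c ≡ positive B′ c)
    features = shapeSet⇒features
      (shape-rigid k (suc m) 1≤k (parts-consistent (suc m) B) (parts-consistent (suc m) B′) same)

boundary-inside : ∀ b l B c → c < l → boundary ((b , l) ∷ B) c ≡ false
boundary-inside b (suc l) B zero    _        = refl
boundary-inside b (suc l) B (suc c) (s≤s lt) = boundary-inside b l B c lt

boundary-end : ∀ b l B → boundary ((b , l) ∷ B) l ≡ true
boundary-end b zero    B = refl
boundary-end b (suc l) B = boundary-end b l B

positive-inside : ∀ b l B c → c ≤ l → positive ((b , l) ∷ B) c ≡ b
positive-inside b zero    B zero    _        = refl
positive-inside b (suc l) B zero    _        = refl
positive-inside b (suc l) B (suc c) (s≤s le) = positive-inside b l B c le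

boundary-after : ∀ b l B c → boundary ((b , l) ∷ B) (suc l + c) ≡ boundary B c
boundary-after b zero    B c = refl
boundary-after b (suc l) B c = boundary-after b l B c

positive-after : ∀ b l B c → positive ((b , l) ∷ B) (suc l + c) ≡ positive B c
positive-after b zero    B c = refl
positive-after b (suc l) B c = positive-after b l B c

-- The integer encoding: the part (b , l) is the nonzero integer ±(l+1).
signed : Bool → ℕ → ℤ
signed true  l = ℤ.+ suc l
signed false l = -[1+ l ]

toInts : Parts → List ℤ
toInts []            = []
toInts ((b , l) ∷ B) = signed b l ∷ toInts B

fromInts : List ℤ → Parts
fromInts []              = []
fromInts (ℤ.+ zero    ∷ μ) = fromInts μ
fromInts (ℤ.+ suc l   ∷ μ) = (true , l) ∷ fromInts μ
fromInts (-[1+ l ]  ∷ μ) = (false , l) ∷ fromInts μ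

NonZeroInts : List ℤ → Set
NonZeroInts = All (λ z → z ≢ ℤ.0ℤ)

toInts-fromInts : ∀ μ → NonZeroInts μ → toInts (fromInts μ) ≡ μ
toInts-fromInts []              _        = refl
toInts-fromInts (ℤ.+ zero    ∷ μ) (z≢0 ∷ _) = contradiction refl z≢0
toInts-fromInts (ℤ.+ suc l   ∷ μ) (_ ∷ nz) = cong (_ ∷_) (toInts-fromInts μ nz)
toInts-fromInts (-[1+ l ]  ∷ μ) (_ ∷ nz) = cong (_ ∷_) (toInts-fromInts μ nz)

size-fromInts : ∀ μ → NonZeroInts μ → size (fromInts μ) ≡ sum (map ∣_∣ μ)
size-fromInts []              _        = refl
size-fromInts (ℤ.+ zero    ∷ μ) (z≢0 ∷ _) = contradiction refl z≢0
size-fromInts (ℤ.+ suc l   ∷ μ) (_ ∷ nz) = cong (λ s → suc l + s) (size-fromInts μ nz)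
size-fromInts (-[1+ l ]  ∷ μ) (_ ∷ nz) = cong (λ s → suc l + s) (size-fromInts μ nz)

toInts-composition : ∀ B → SignedComposition (size B) (toInts B)
toInts-composition B = nonZero B , sizes B
  where
    nonZero : ∀ B → NonZeroInts (toInts B)
    nonZero []                = []
    nonZero ((true  , l) ∷ B) = (λ ()) ∷ nonZero B
    nonZero ((false , l) ∷ B) = (λ ()) ∷ nonZero B
    sizes : ∀ B → sum (map ∣_∣ (toInts B)) ≡ size B
    sizes []                = refl
    sizes ((true  , l) ∷ B) = cong (λ s → suc l + s) (sizes B)
    sizes ((false , l) ∷ B) = cong (λ s → suc l + s) (sizes B)

composition⇒parts : ∀ n μ → SignedComposition n μ → Σ Parts λ B → size B ≡ n × toInts B ≡ μ
composition⇒parts n μ (nz , total) = fromInts μ , trans (size-fromInts μ nz) total , toInts-fromInts μ nz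

Block : Set
Block = ℕ × ℕ × ℤ

StrictlyInside : ℕ → Block → Set
StrictlyInside x (a , b , _) = a < x × x < b

InPositive : ℕ → Block → Set
InPositive x (a , b , m) = a < x × x ≤ b × ℤ.0ℤ <ℤ m

blocks-∷ : ∀ off b l B → blocks off (toInts ((b , l) ∷ B))
                       ≡ (off , off + suc l , signed b l) ∷ blocks (off + suc l) (toInts B)
blocks-∷ off true  l B = refl
blocks-∷ off false l B = refl

blocks-beyond : ∀ {P : Block → Set} {x} → (∀ {a b m} → P (a , b , m) → a < x) →
                ∀ off μ → x ≤ off → ¬ Any P (blocks off μ)
blocks-beyond below off (m ∷ μ) x≤off (here p)  = <⇒≱ (below p) x≤off
blocks-beyond below off (m ∷ μ) x≤off (there p) =
  blocks-beyond below (off + ∣ m ∣) μ (≤-trans x≤off (m≤m+n off _)) p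

shift : ∀ off l c → off + suc (suc l + c) ≡ (off + suc l) + suc c
shift off l c = trans (cong (λ z → off + suc z) (sym (+-suc l c))) (sym (+-assoc off (suc l) (suc c)))

beyond : ∀ {l c} → l < c → ∃ λ c′ → c ≡ suc l + c′
beyond lt = let (c′ , e) = m≤n⇒∃[o]m+o≡n lt in c′ , sym e

strictlyInside⇒uncut : ∀ B off c → Any (StrictlyInside (off + suc c)) (blocks off (toInts B)) →
                       boundary B c ≡ false
strictlyInside⇒uncut ((b , l) ∷ B) off c h with subst (Any _) (blocks-∷ off b l B) h
... | here (_ , lt) = boundary-inside b l B c (≤-pred (+-cancelˡ-< off (suc c) (suc l) lt))
... | there h′ with <-cmp c l
...   | tri< lt _ _ = boundary-inside b l B c lt
...   | tri≈ _ refl _ = ⊥-elim (blocks-beyond proj₁ (off + suc c) (toInts B) ≤-refl h′)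
...   | tri> _ _ gt with beyond gt
...     | c′ , refl = trans (boundary-after b l B c′)
                        (strictlyInside⇒uncut B (off + suc l) c′ (subst (λ x → Any (StrictlyInside x) (blocks (off + suc l) (toInts B))) (shift off l c′) h′))

uncut⇒strictlyInside : ∀ B off c → suc c < size B → boundary B c ≡ false →
                       Any (StrictlyInside (off + suc c)) (blocks off (toInts B))
uncut⇒strictlyInside ((b , l) ∷ B) off c lt uncut = subst (Any _) (sym (blocks-∷ off b l B)) located
  where
    located : Any (StrictlyInside (off + suc c)) ((off , off + suc l , signed b l) ∷ blocks (off + suc l) (toInts B))
    located with <-cmp c l
    ... | tri< c<l _ _ = here (m<m+n off (s≤s z≤n) , +-monoʳ-< off (s≤s c<l))
    ... | tri≈ _ refl _ = contradiction (trans (sym (boundary-end b l B)) uncut) (λ ())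
    ... | tri> _ _ gt with beyond gt
    ...   | c′ , refl = there (subst (λ x → Any (StrictlyInside x) (blocks (off + suc l) (toInts B))) (sym (shift off l c′))
              (uncut⇒strictlyInside B (off + suc l) c′
                 (+-cancelˡ-< (suc l) _ _ (subst (_< suc l + size B) (cong suc (sym (+-suc l c′))) lt))
                 (trans (sym (boundary-after b l B c′)) uncut)))

signed-positive : ∀ b l → ℤ.0ℤ <ℤ signed b l → b ≡ true
signed-positive true  l _  = refl
signed-positive false l ()

inPositive⇒positive : ∀ B off c → Any (InPositive (off + suc c)) (blocks off (toInts B)) →
                      positive B c ≡ true
inPositive⇒positive ((b , l) ∷ B) off c h with subst (Any _) (blocks-∷ off b l B) h
... | here (_ , le , m>0) =
  trans (positive-inside b l B c (≤-pred (+-cancelˡ-≤ off (suc c) (suc l) le))) (signed-positive b l m>0)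
... | there h′ with ≤-<-connex c l
...   | inj₁ c≤l = ⊥-elim (blocks-beyond proj₁ (off + suc l) (toInts B) (+-monoʳ-≤ off (s≤s c≤l)) h′)
...   | inj₂ gt with beyond gt
...     | c′ , refl = trans (positive-after b l B c′)
                        (inPositive⇒positive B (off + suc l) c′ (subst (λ x → Any (InPositive x) (blocks (off + suc l) (toInts B))) (shift off l c′) h′))

positive⇒inPositive : ∀ B off c → c < size B → positive B c ≡ true →
                      Any (InPositive (off + suc c)) (blocks off (toInts B))
positive⇒inPositive ((b , l) ∷ B) off c lt pos = subst (Any _) (sym (blocks-∷ off b l B)) located
  where
    located : Any (InPositive (off + suc c)) ((off , off + suc l , signed b l) ∷ blocks (off + suc l) (toInts B))
    located with ≤-<-connex c l
    ... | inj₁ c≤l with trans (sym (positive-inside b l B c c≤l)) pos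
    ...   | refl = here (m<m+n off (s≤s z≤n) , +-monoʳ-≤ off (s≤s c≤l) , ℤ.+<+ (s≤s z≤n))
    located | inj₂ gt with beyond gt
    ...   | c′ , refl = there (subst (λ x → Any (InPositive x) (blocks (off + suc l) (toInts B))) (sym (shift off l c′))
              (positive⇒inPositive B (off + suc l) c′ (+-cancelˡ-< (suc l) c′ (size B) lt)
                 (trans (sym (positive-after b l B c′)) pos)))

partsSet⇔PiMu : ∀ {n} B → size B ≡ n → ∀ (p : PiIdx n) → T (partsSet B p) ⇔ PiMu (toInts B) p
partsSet⇔PiMu {n} B sz (tI j) = mk⇔
  (λ t → Any.map (λ { {a , b , m} h → h })
           (positive⇒inPositive B 0 (toℕ j) (subst (toℕ j <_) (sym sz) (toℕ<n j)) (Equivalence.to T-≡ t)))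
  (λ x → Equivalence.from T-≡ (inPositive⇒positive B 0 (toℕ j) (Any.map (λ { {a , b , m} h → h }) x)))
partsSet⇔PiMu {n} B sz (sI i 1≤i) = mk⇔
  (λ t → Any.map (λ { {a , b , m} h → h })
           (subst (λ x → Any (StrictlyInside x) (blocks 0 (toInts B))) i≡
             (uncut⇒strictlyInside B 0 c (subst (suc c <_) (sym sz) (subst (_< n) (sym i≡) (toℕ<n i)))
                                   (Equivalence.to T-not-≡ t))))
  (λ x → Equivalence.from T-not-≡ (strictlyInside⇒uncut B 0 c
           (subst (λ x → Any (StrictlyInside x) (blocks 0 (toInts B))) (sym i≡)
             (Any.map (λ { {a , b , m} h → h }) x))))
  where
    c : ℕ
    c = pred (toℕ i)
    i≡ : suc c ≡ toℕ i
    i≡ = suc-pred (toℕ i) {{>-nonZero 1≤i}}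

sameSub-parts-PiMu : ∀ n r B → size B ≡ n → SameSub n r (toPred (partsSet B)) (PiMu (toInts B))
sameSub-parts-PiMu n r B sz = sameSub-intro
  (λ p t → InGen-gen p (Equivalence.to (partsSet⇔PiMu B sz p) t))
  (λ p x → InGen-gen p (Equivalence.from (partsSet⇔PiMu B sz p) x))
  where open Generated n r

build : (cut pos : ℕ → Bool) → ℕ → Parts
build cut pos zero    = (pos 0 , 0) ∷ []
build cut pos (suc m) = if cut 0 then (pos 0 , 0) ∷ rest else grow rest
  where
    rest : Parts
    rest = build (cut ∘ suc) (pos ∘ suc) m

grow-size : ∀ B {m} → size B ≡ suc m → size (grow B) ≡ suc (suc m)
grow-size ((b , l) ∷ B) sz = cong suc sz

boundary-grow-zero : ∀ B → boundary (grow B) 0 ≡ false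
boundary-grow-zero []            = refl
boundary-grow-zero ((b , l) ∷ B) = refl

boundary-grow : ∀ B c → boundary (grow B) (suc c) ≡ boundary B c
boundary-grow []            c = refl
boundary-grow ((b , l) ∷ B) c = refl

positive-grow : ∀ B c → positive (grow B) c ≡ positive B (pred c)
positive-grow []                zero    = refl
positive-grow []                (suc c) = refl
positive-grow ((b , zero)  ∷ B) zero    = refl
positive-grow ((b , suc l) ∷ B) zero    = refl
positive-grow ((b , l)     ∷ B) (suc c) = refl

size-build : ∀ cut pos m → size (build cut pos m) ≡ suc m
size-build cut pos zero    = refl
size-build cut pos (suc m) with cut 0
... | true  = cong suc (size-build (cut ∘ suc) (pos ∘ suc) m)
... | false = grow-size (build (cut ∘ suc) (pos ∘ suc) m) (size-build (cut ∘ suc) (pos ∘ suc) m)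

boundary-build : ∀ cut pos m c → c < m → boundary (build cut pos m) c ≡ cut c
boundary-build cut pos (suc m) c lt with cut 0 in cut0 | c
... | true  | zero  = sym cut0
... | true  | suc c = boundary-build (cut ∘ suc) (pos ∘ suc) m c (≤-pred lt)
... | false | zero  = trans (boundary-grow-zero (build (cut ∘ suc) (pos ∘ suc) m)) (sym cut0)
... | false | suc c = trans (boundary-grow (build (cut ∘ suc) (pos ∘ suc) m) c)
                            (boundary-build (cut ∘ suc) (pos ∘ suc) m c (≤-pred lt))

consistent-suc : ∀ {m cut pos} → Consistent (suc m) cut pos → Consistent m (cut ∘ suc) (pos ∘ suc)
consistent-suc consistent c lt = consistent (suc c) (s≤s lt)

positive-build : ∀ cut pos m → Consistent (suc m) cut pos → ∀ c → c ≤ m → positive (build cut pos m) c ≡ pos c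
positive-build cut pos zero    _          zero _  = refl
positive-build cut pos (suc m) consistent c  le with cut 0 in cut0 | c
... | true  | zero  = refl
... | true  | suc c = positive-build (cut ∘ suc) (pos ∘ suc) m (consistent-suc consistent) c (≤-pred le)
... | false | zero  = trans (positive-grow (build (cut ∘ suc) (pos ∘ suc) m) 0)
                           (trans (positive-build (cut ∘ suc) (pos ∘ suc) m (consistent-suc consistent) 0 z≤n)
                                  (sym (consistent 0 (s≤s (s≤s z≤n)) cut0)))
... | false | suc c = trans (positive-grow (build (cut ∘ suc) (pos ∘ suc) m) (suc c))
                            (positive-build (cut ∘ suc) (pos ∘ suc) m (consistent-suc consistent) c (≤-pred le))

shape⇒parts : ∀ m cut pos → Consistent (suc m) cut pos →
              Σ Parts λ B → size B ≡ suc m × (∀ p → shapeSet {suc m} cut pos p ≡ partsSet B p)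
shape⇒parts m cut pos consistent =
  B , size-build cut pos m ,
  features⇒shapeSet (λ c lt → sym (boundary-build cut pos m c (≤-pred lt)))
                    (λ c lt → sym (positive-build cut pos m consistent c (≤-pred lt)))
  where
    B : Parts
    B = build cut pos m

-- All parts of size m+1.  Parts of size m+2 arise from those of size m+1
-- either by growing the first block or by prepending a block of length
-- one of either sign, and these three operations are injective with
-- disjoint images; hence there are 2·3^m parts of size m+1.
allParts : ℕ → List Parts
allParts zero    = ((true , 0) ∷ []) ∷ ((false , 0) ∷ []) ∷ []
allParts (suc m) = map grow Ps ++ map ((true , 0) ∷_) Ps ++ map ((false , 0) ∷_) Ps
  where
    Ps : List Parts
    Ps = allParts m

allParts-length : ∀ m → length (allParts m) ≡ 2 * 3 ^ m
allParts-length zero    = refl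
allParts-length (suc m) = begin
  length (map grow Ps ++ map ((true , 0) ∷_) Ps ++ map ((false , 0) ∷_) Ps)
    ≡⟨ length-++ (map grow Ps) ⟩
  length (map grow Ps) + length (map ((true , 0) ∷_) Ps ++ map ((false , 0) ∷_) Ps)
    ≡⟨ cong (length (map grow Ps) +_) (length-++ (map ((true , 0) ∷_) Ps)) ⟩
  length (map grow Ps) + (length (map ((true , 0) ∷_) Ps) + length (map ((false , 0) ∷_) Ps))
    ≡⟨ cong₂ _+_ (length-map grow Ps) (cong₂ _+_ (length-map _ Ps) (length-map _ Ps)) ⟩
  length Ps + (length Ps + length Ps)
    ≡⟨ cong (λ L → L + (L + L)) (allParts-length m) ⟩
  2 * 3 ^ m + (2 * 3 ^ m + 2 * 3 ^ m)
    ≡⟨ cong (λ L → 2 * 3 ^ m + (2 * 3 ^ m + L)) (+-identityʳ (2 * 3 ^ m)) ⟨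
  3 * (2 * 3 ^ m)
    ≡⟨ *-assoc 3 2 (3 ^ m) ⟨
  6 * 3 ^ m
    ≡⟨ *-assoc 2 3 (3 ^ m) ⟩
  2 * 3 ^ suc m ∎
  where
    open ≡-Reasoning
    Ps : List Parts
    Ps = allParts m

allParts-size : ∀ m → All (λ B → size B ≡ suc m) (allParts m)
allParts-size zero    = refl ∷ refl ∷ []
allParts-size (suc m) =
  AllP.++⁺ (AllP.map⁺ (All.map (λ {B} → grow-size B) (allParts-size m)))
           (AllP.++⁺ (AllP.map⁺ (All.map (cong suc) (allParts-size m)))
                     (AllP.map⁺ (All.map (cong suc) (allParts-size m))))

allParts-complete : ∀ m B → size B ≡ suc m → Any (B ≡_) (allParts m)
allParts-complete zero ((true  , zero) ∷ []) refl = here refl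
allParts-complete zero ((false , zero) ∷ []) refl = there (here refl)
allParts-complete zero ((_ , zero) ∷ _ ∷ _) ()
allParts-complete zero ((_ , suc l) ∷ _)    ()
allParts-complete (suc m) ((b , suc l) ∷ B) sz =
  AnyP.++⁺ˡ (AnyP.map⁺ (Any.map (cong grow) (allParts-complete m ((b , l) ∷ B) (suc-injective sz))))
allParts-complete (suc m) ((true , zero) ∷ B) sz =
  AnyP.++⁺ʳ (map grow (allParts m))
    (AnyP.++⁺ˡ (AnyP.map⁺ (Any.map (cong ((true , 0) ∷_)) (allParts-complete m B (suc-injective sz)))))
allParts-complete (suc m) ((false , zero) ∷ B) sz =
  AnyP.++⁺ʳ (map grow (allParts m)) (AnyP.++⁺ʳ (map ((true , 0) ∷_) (allParts m))
    (AnyP.map⁺ (Any.map (cong ((false , 0) ∷_)) (allParts-complete m B (suc-injective sz)))))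

allParts-distinct : ∀ m → AllPairs (λ B B′ → B ≢ B′) (allParts m)
allParts-distinct zero    = ((λ ()) ∷ []) ∷ [] ∷ []
allParts-distinct (suc m) =
  AllPairsP.++⁺ (injective grow-injective)
    (AllPairsP.++⁺ (injective ∷-injectiveʳ) (injective ∷-injectiveʳ)
                   (apart (λ B B′ ())))
    (AllP.map⁺ (All.universal (λ B → AllP.++⁺ (apart′ grow-new B) (apart′ grow-new B)) (allParts m)))
  where
    Ps : List Parts
    Ps = allParts m
    injective : ∀ {f : Parts → Parts} → (∀ {B B′} → f B ≡ f B′ → B ≡ B′) →
                AllPairs (λ B B′ → B ≢ B′) (map f Ps)
    injective inj = AllPairsP.map⁺ (AllPairs.map (λ B≢B′ e → B≢B′ (inj e)) (allParts-distinct m))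
    apart′ : ∀ {f g : Parts → Parts} → (∀ B B′ → f B ≢ g B′) → ∀ B → All (f B ≢_) (map g Ps)
    apart′ disjoint B = AllP.map⁺ (All.universal (disjoint B) Ps)
    apart : ∀ {f g : Parts → Parts} → (∀ B B′ → f B ≢ g B′) → All (λ x → All (x ≢_) (map g Ps)) (map f Ps)
    apart disjoint = AllP.map⁺ (All.universal (apart′ disjoint) Ps)
    grow-injective : ∀ {B B′} → grow B ≡ grow B′ → B ≡ B′
    grow-injective {[]}          {[]}            _    = refl
    grow-injective {(b , l) ∷ B} {(b′ , l′) ∷ B′} refl = refl
    grow-new : ∀ {b} B B′ → grow B ≢ (b , 0) ∷ B′
    grow-new []            B′ ()
    grow-new ((_ , _) ∷ B) B′ ()

tAux-cong : ∀ {n a b} → a ≡ b → (p : a < n) (q : b < n) → tAux a p ≡ tAux b q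
tAux-cong {a = a} refl p q = cong (tAux a) (≤-irrelevant p q)

sI-cong : ∀ {n} {i i′ : Fin n} {h h′} → i ≡ i′ → sI i h ≡ sI i′ h′
sI-cong refl = cong (sI _) (≤-irrelevant _ _)

-- Read at positions, sJ c says
-- s_{c+1} ∈ J and tJ c says t_{c+1} ∈ J.  The closure cuts exactly where
-- s_{c+1} ∉ J, and the block of c is positive iff t_{c+1} can be reached
-- from some t_{j+1} ∈ J through a chain of s's of J, to the left or to
-- the right.
module Closure (n r : ℕ) (J : PiIdx n → Bool) where
  open Congruence n r
  open Generated n r

  sJ : ℕ → Bool
  sJ c with suc c <? n
  ... | yes lt = J (sAt lt)
  ... | no _   = false

  tJ : ℕ → Bool
  tJ c with c <? n
  ... | yes lt = J (tAt lt)
  ... | no _   = false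

  sJ-at : ∀ {c} (lt : suc c < n) → sJ c ≡ J (sAt lt)
  sJ-at {c} lt with suc c <? n
  ... | yes lt′ = cong (J ∘ sAt) (≤-irrelevant lt′ lt)
  ... | no ¬lt  = contradiction lt ¬lt

  tJ-at : ∀ {c} (lt : c < n) → tJ c ≡ J (tAt lt)
  tJ-at {c} lt with c <? n
  ... | yes lt′ = refl
  ... | no ¬lt  = contradiction lt ¬lt

  sJ-bound : ∀ c → T (sJ c) → suc c < n
  sJ-bound c s with suc c <? n
  ... | yes lt = lt

  J-s : ∀ (i : Fin n) h → J (sI i h) ≡ sJ (pred (toℕ i))
  J-s i h = sym (trans (sJ-at lt) (cong J (sI-cong fromℕ<-i)))
    where
      lt : suc (pred (toℕ i)) < n
      lt = subst (_< n) (sym (suc-pred (toℕ i) {{>-nonZero h}})) (toℕ<n i)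
      fromℕ<-i : fromℕ< lt ≡ i
      fromℕ<-i = trans (fromℕ<-cong _ _ (suc-pred (toℕ i) {{>-nonZero h}}) lt (toℕ<n i)) (fromℕ<-toℕ i (toℕ<n i))

  J-t : ∀ (j : Fin n) → J (tI j) ≡ tJ (toℕ j)
  J-t j = sym (trans (tJ-at (toℕ<n j)) (cong (J ∘ tI) (fromℕ<-toℕ j (toℕ<n j))))

  -- Reach c: t_{c+1} lies in ⟨J⟩.  It holds when t_{c+1} ∈ J, and passes
  -- between c and c+1 when s_{c+1} ∈ J, as t_{c+2} = s_{c+1} t_{c+1} s_{c+1}.
  Reach : ℕ → Set
  Reach c = ∀ (lt : c < n) → InGen n r (toPred J) (tAux c lt)

  reach-t : ∀ c → T (tJ c) → Reach c
  reach-t c t lt = subst (InGen n r (toPred J)) (tAux-cong (toℕ-fromℕ< lt) _ lt)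
                         (InGen-gen (tAt lt) (subst T (tJ-at lt) t))

  reach-right : ∀ c → T (sJ c) → Reach c → Reach (suc c)
  reach-right c s reach lt = InGen-++ sIn (InGen-++ (reach _) sIn)
    where
      sIn : InGen n r (toPred J) (gen (fromℕ< lt) ∷ [])
      sIn = InGen-gen (sAt lt) (subst T (sJ-at lt) s)

  reach-left : ∀ c → T (sJ c) → Reach (suc c) → Reach c
  reach-left c s reach lt =
    InGen-resp conjugate (InGen-++ sIn (InGen-++ (reach lt′) sIn))
    where
      lt′ : suc c < n
      lt′ = sJ-bound c s
      g : Letter n
      g = gen (fromℕ< lt′)
      sIn : InGen n r (toPred J) (g ∷ [])
      sIn = InGen-gen (sAt lt′) (subst T (sJ-at lt′) s)
      X : Word n
      X = tAux c lt
      involution : Eq n r (g ∷ g ∷ []) []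
      involution = eq-rel (invol (fromℕ< lt′) (subst (1 ≤_) (sym (toℕ-fromℕ< lt′)) (s≤s z≤n)))
      conjugate : Eq n r X (g ∷ tAux (suc c) lt′ ++ g ∷ [])
      conjugate = begin
        X                                     ≡⟨ ++-identityʳ X ⟨
        [] ++ X ++ []                         ≈⟨ ++-cong involution (++-cong {X} eq-refl involution) ⟨
        (g ∷ g ∷ []) ++ X ++ (g ∷ g ∷ [])     ≡⟨ cong (λ Y → g ∷ g ∷ Y) (++-assoc X (g ∷ []) (g ∷ [])) ⟨
        g ∷ (g ∷ X ++ g ∷ []) ++ g ∷ []       ≡⟨ cong (λ Y → g ∷ (g ∷ Y ++ g ∷ []) ++ g ∷ []) (tAux-cong refl lt _) ⟩
        g ∷ tAux (suc c) lt′ ++ g ∷ []        ∎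
        where open SetoidReasoning wordSetoid

  -- t_{c+1} reachable from a t of J walking left, resp. right (with fuel).
  reachL : ℕ → Bool
  reachL zero    = tJ zero
  reachL (suc c) = tJ (suc c) ∨ (sJ c ∧ reachL c)

  reachR : ℕ → ℕ → Bool
  reachR zero    c = tJ c
  reachR (suc f) c = tJ c ∨ (sJ c ∧ reachR f (suc c))

  closureCut closurePos : ℕ → Bool
  closureCut c = not (sJ c)
  closurePos c = reachL c ∨ reachR (n ∸ c) c

  Closed : PiIdx n → Bool
  Closed = shapeSet closureCut closurePos

  reachL-reach : ∀ c → T (reachL c) → Reach c
  reachL-reach zero    t = reach-t zero t
  reachL-reach (suc c) t with Equivalence.to T-∨ t
  ... | inj₁ t′ = reach-t (suc c) t′
  ... | inj₂ st = let (s , t′) = Equivalence.to T-∧ st in reach-right c s (reachL-reach c t′)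

  reachR-reach : ∀ f c → T (reachR f c) → Reach c
  reachR-reach zero    c t = reach-t c t
  reachR-reach (suc f) c t with Equivalence.to T-∨ t
  ... | inj₁ t′ = reach-t c t′
  ... | inj₂ st = let (s , t′) = Equivalence.to T-∧ st in reach-left c s (reachR-reach f (suc c) t′)

  closurePos-reach : ∀ c → T (closurePos c) → Reach c
  closurePos-reach c t with Equivalence.to T-∨ t
  ... | inj₁ t′ = reachL-reach c t′
  ... | inj₂ t′ = reachR-reach (n ∸ c) c t′

  tJ-reachL : ∀ c → tJ c ∨ reachL c ≡ reachL c
  tJ-reachL zero    = ∨-idem (tJ zero)
  tJ-reachL (suc c) = trans (sym (∨-assoc (tJ (suc c)) (tJ (suc c)) _)) (cong (_∨ (sJ c ∧ reachL c)) (∨-idem (tJ (suc c))))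

  tJ-reachR : ∀ f c → tJ c ∨ reachR f c ≡ reachR f c
  tJ-reachR zero    c = ∨-idem (tJ c)
  tJ-reachR (suc f) c = trans (sym (∨-assoc (tJ c) (tJ c) _)) (cong (_∨ (sJ c ∧ reachR f (suc c))) (∨-idem (tJ c)))

  tJ-closurePos : ∀ c → T (tJ c) → T (closurePos c)
  tJ-closurePos c t =
    Equivalence.from T-∨ (inj₁ (subst T (tJ-reachL c) (Equivalence.from T-∨ (inj₁ t))))

  -- Across an s of J, both reachability predicates agree: the block of c
  -- and c+1 is positive iff reachL c ∨ reachR (suc c) holds.
  closure-consistent : Consistent n closureCut closurePos
  closure-consistent c lt uncut = begin
    reachL c ∨ reachR (n ∸ c) c                   ≡⟨ cong (λ f → reachL c ∨ reachR f c) (+-∸-assoc 1 (<⇒≤ lt)) ⟩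
    reachL c ∨ (tJ c ∨ (sJ c ∧ R))                ≡⟨ cong (λ b → reachL c ∨ (tJ c ∨ (b ∧ R))) s ⟩
    reachL c ∨ (tJ c ∨ R)                         ≡⟨ rearrange (reachL c) (tJ c) R ⟩
    (tJ c ∨ reachL c) ∨ R                         ≡⟨ cong (_∨ R) (tJ-reachL c) ⟩
    reachL c ∨ R                                  ≡⟨ cong (reachL c ∨_) (tJ-reachR (n ∸ suc c) (suc c)) ⟨
    reachL c ∨ (tJ (suc c) ∨ R)                   ≡⟨ rearrange (reachL c) (tJ (suc c)) R ⟩
    (tJ (suc c) ∨ reachL c) ∨ R                   ≡⟨ cong (λ b → (tJ (suc c) ∨ (b ∧ reachL c)) ∨ R) s ⟨
    reachL (suc c) ∨ reachR (n ∸ suc c) (suc c)   ∎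
    where
      open ≡-Reasoning
      R : Bool
      R = reachR (n ∸ suc c) (suc c)
      s : sJ c ≡ true
      s = trans (sym (not-involutive (sJ c))) (cong not uncut)
      rearrange : ∀ a b x → a ∨ (b ∨ x) ≡ (b ∨ a) ∨ x
      rearrange a b x = trans (sym (∨-assoc a b x)) (cong (_∨ x) (∨-comm a b))

  closure-same : SameSub n r (toPred J) (toPred Closed)
  closure-same = sameSub-intro inClosure fromJ
    where
      inClosure : ∀ p → T (J p) → InGen n r (toPred Closed) (piWord p)
      inClosure (tI j)   t = InGen-gen (tI j) (tJ-closurePos (toℕ j) (subst T (J-t j) t))
      inClosure (sI i h) t =
        InGen-gen (sI i h) (subst T (sym (not-involutive (sJ (pred (toℕ i))))) (subst T (J-s i h) t))
      fromJ : ∀ p → T (Closed p) → InGen n r (toPred J) (piWord p)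
      fromJ (tI j)   t = closurePos-reach (toℕ j) t (toℕ<n j)
      fromJ (sI i h) t =
        InGen-gen (sI i h) (subst T (sym (J-s i h)) (subst T (not-involutive (sJ (pred (toℕ i)))) t))

classify : ∀ m r (J : PiIdx (suc m) → Bool) →
           Σ Parts λ B → size B ≡ suc m × SameSub (suc m) r (toPred J) (toPred (partsSet B))
classify m r J =
  let (B , sz , same) = shape⇒parts m closureCut closurePos closure-consistent
  in B , sz , sameSub-trans closure-same (sameSub-≗ same)
  where
    open Closure (suc m) r J
    open Generated (suc m) r

composition-unique : ∀ k m B ν → 1 ≤ k → size B ≡ suc m → SignedComposition (suc m) ν →
                     SameSub (suc m) (suc k) (toPred (partsSet B)) (PiMu ν) → ν ≡ toInts B
composition-unique k m B ν 1≤k sz composition same with composition⇒parts (suc m) ν composition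
... | B′ , sz′ , refl = cong toInts (parts-rigid k m B′ B 1≤k sz′ sz sameShapes)
  where
    open Generated (suc m) (suc k)
    sameShapes : SameSub (suc m) (suc k) (toPred (partsSet B′)) (toPred (partsSet B))
    sameShapes = sameSub-trans (sameSub-parts-PiMu (suc m) (suc k) B′ sz′) (sameSub-sym same)

AllPairs-restrict : ∀ {A : Set} {P : A → Set} {R S : A → A → Set} →
                    (∀ {x y} → P x → P y → R x y → S x y) →
                    ∀ {xs} → All P xs → AllPairs R xs → AllPairs S xs
AllPairs-restrict f []         []         = []
AllPairs-restrict {P = P} {R} {S} f (px ∷ pxs) (rx ∷ rxs) = pairs px pxs rx ∷ AllPairs-restrict f pxs rxs
  where
    pairs : ∀ {x ys} → P x → All P ys → All (R x) ys → All (S x) ys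
    pairs px []         []         = []
    pairs px (py ∷ pys) (r ∷ rs)   = f px py r ∷ pairs px pys rs

allParts-subgroups-distinct : ∀ k m → 1 ≤ k →
  AllPairs (λ B B′ → ¬ SameSub (suc m) (suc k) (toPred (partsSet B)) (toPred (partsSet B′))) (allParts m)
allParts-subgroups-distinct k m 1≤k =
  AllPairs-restrict (λ sz sz′ B≢B′ same → B≢B′ (parts-rigid k m _ _ 1≤k sz sz′ same))
                    (allParts-size m) (allParts-distinct m)

unique-composition : ∀ m k → 1 ≤ k → (J : PiIdx (suc m) → Bool) →
  Σ (List ℤ) λ μ → SignedComposition (suc m) μ
    × SameSub (suc m) (suc k) (toPred J) (PiMu μ)
    × ((ν : List ℤ) → SignedComposition (suc m) ν → SameSub (suc m) (suc k) (toPred J) (PiMu ν) → ν ≡ μ)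
unique-composition m k 1≤k J with classify m (suc k) J
... | B , sz , sameB =
  toInts B
  , subst (λ s → SignedComposition s (toInts B)) sz (toInts-composition B)
  , sameSub-trans sameB (sameSub-parts-PiMu (suc m) (suc k) B sz)
  , λ ν composition sameν →
      composition-unique k m B ν 1≤k sz composition (sameSub-trans (sameSub-sym sameB) sameν)
  where open Generated (suc m) (suc k)

reflection-subgroups : ∀ m k → 1 ≤ k →
  Σ (List (PiIdx (suc m) → Bool)) λ Js → length Js ≡ 2 * 3 ^ m
    × AllPairs (λ J J′ → ¬ SameSub (suc m) (suc k) (toPred J) (toPred J′)) Js
    × ((J : PiIdx (suc m) → Bool) → Any (λ J′ → SameSub (suc m) (suc k) (toPred J) (toPred J′)) Js)
reflection-subgroups m k 1≤k =
  map partsSet (allParts m)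
  , trans (length-map partsSet (allParts m)) (allParts-length m)
  , AllPairsP.map⁺ (allParts-subgroups-distinct k m 1≤k)
  , λ J → let (B , sz , sameB) = classify m (suc k) J in
          AnyP.map⁺ (Any.map (λ B≡B′ → subst (λ B′ → SameSub (suc m) (suc k) (toPred J) (toPred (partsSet B′))) B≡B′ sameB)
                             (allParts-complete m B sz))

proposition3p3 : (n r : ℕ) → 1 ≤ n → 2 ≤ r →
    ((J : PiIdx n → Bool) →
      Σ (List ℤ) (λ μ →
        SignedComposition n μ
        × SameSub n r (toPred J) (PiMu μ)
        × ((ν : List ℤ) → SignedComposition n ν → SameSub n r (toPred J) (PiMu ν) → ν ≡ μ)))
    × Σ (List (PiIdx n → Bool)) (λ Js →
        length Js ≡ 2 * 3 ^ (n ∸ 1)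
        × AllPairs (λ J J′ → ¬ SameSub n r (toPred J) (toPred J′)) Js
        × ((J : PiIdx n → Bool) → Any (λ J′ → SameSub n r (toPred J) (toPred J′)) Js))
proposition3p3 (suc m) (suc k) _ (s≤s 1≤k) = unique-composition m k 1≤k , reflection-subgroups m k 1≤k
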